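{- Let $D$ be a rank $k$ partial flag positroid pipe dream with pivot columns $u_1>\dots>u_k$, and let $\pi$ be its decorated permutation. Then $j$ is an unblocked column of $D$ if and only if $j$ is an unblocked position of $\pi$.
   Context: Pipe dreams: $n\times n$ array, box $(i,j)$ in row $i$ from the top, column $j$ from the left, tiled by: empty; horizontal pipe; vertical pipe; pivot elbow (one arc from top-edge midpoint to right-edge midpoint); cross; elbow (two arcs: top to right, and left to bottom). A Rothe pipe dream of $u\in\mathfrak S_n$: (i) $n$ pipes each from the top edge to the right edge; (ii) $(i,u_i)$ is a pivot elbow; (iii) boxes $(i,j)$ with $u^{ -1}(j)<i$, $j<u_i$ empty; (iv) boxes with $u^{ -1}(j)<i$, $j>u_i$ horizontal pipes; (v) boxes with $u^{ -1}(j)>i$, $j<u_i$ vertical pipes; remaining boxes crosses or elbows. Reduced: no two pipes cross twice. Exit permutation $v$: $v_i$ = starting column of the pipe leaving the right edge in row $i$. Pipes touch if they share an elbow tile. $\mathrm{FPP}(u,v)$ is a reduced Rothe pipe dream of $u$ with exit permutation $v$ in which two pipes that cross never touch southeast of their crossing. A rank $k$ partial flag positroid pipe dream is the restriction of an $n\times n$ $\mathrm{FPP}$ to its first $k$ rows. For such $D$ with pivot columns $u_1>\dots>u_k$: a column is blocked if it is a pivot column or contains a cross tile with an elbow tile to its right in the same row; otherwise unblocked. The trivial completion of $D$ is the $\mathrm{FPP}(u,v)$ whose first $k$ rows are $D$ and whose pivot columns satisfy $u_{k+1}>\dots>u_n$. The decorated permutation of $D$ is the permutation $\pi=vu^{ -1}$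 (so $\pi(u_i)=v_i$) together with a colouring: position $j$ is $2$-coloured (value $\pi(j)$ decorated with an overline) if $j\in\{u_1,\dots,u_k\}$, and $1$-coloured (value underlined) otherwise. A position $j$ is an unblocked position of $\pi$ if $j$ is $1$-coloured and every $1$-coloured position $j'>j$ has $\pi(j')>\pi(j)$. -}

module Defs where

open import Data.Nat as ℕ using (ℕ; zero; suc; _<?_)
open import Data.Fin as Fin using (Fin; toℕ; fromℕ<; inject≤)
open import Data.Fin.Permutation using (Permutation′; _⟨$⟩ʳ_; _⟨$⟩ˡ_)
open import Data.Maybe using (Maybe; just; nothing)
open import Data.List using (List; []; _∷_)
open import Data.List.Membership.Propositional using (_∈_)
open import Data.Product using (_×_; _,_; ∃; ∃-syntax)
open import Data.Sum using (_⊎_)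
open import Relation.Nullary using (¬_; yes; no)
open import Relation.Binary.PropositionalEquality using (_≡_; _≢_)

-- Conventions: rows and columns are 0-indexed (Fin n); row 0 is the top row,
-- column 0 is the leftmost column.  Orders on Fin n are the usual ones.

data Tile : Set where
  empty      : Tile
  horizontal : Tile
  vertical   : Tile
  pivot      : Tile   -- pivot elbow: one arc, top edge to right edge
  cross      : Tile
  elbow      : Tile   -- elbow: two arcs, top to right and left to bottom

-- An n × n array of tiles; box (i , j) = row i, column j.
Grid : ℕ → Set
Grid n = Fin n → Fin n → Tile

-- A k × n array of tiles (first k rows of an n × n array).
PGrid : ℕ → ℕ → Set
PGrid k n = Fin k → Fin n → Tile

data Entry : Set where
  fromTop fromLeft : Entry

data Exit : Set where
  toBottom toRight : Exit

move : Tile → Entry → Maybe Exit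
move vertical   fromTop  = just toBottom
move pivot      fromTop  = just toRight
move cross      fromTop  = just toBottom
move elbow      fromTop  = just toRight
move horizontal fromLeft = just toRight
move cross      fromLeft = just toRight
move elbow      fromLeft = just toBottom
move _          _        = nothing

tileAt : ∀ {n} → Grid n → ℕ → ℕ → Maybe Tile
tileAt {n} G i j with i <? n | j <? n
... | yes p | yes q = just (G (fromℕ< p) (fromℕ< q))
... | _     | _     = nothing

data Outcome : Set where
  exitsRight : ℕ → Outcome   -- leaves through the right edge of the array in this row
  broken     : Outcome       -- gets stuck / leaves the array elsewhere / out of fuel

-- A visited box: (row , column , side of entry).
Visit : Set
Visit = ℕ × ℕ × Entry

follow : ∀ {n} → Grid n → ℕ → ℕ → ℕ → Entry → List Visit × Outcome
follow G zero i j e = [] , broken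
follow {n} G (suc fuel) i j e with tileAt G i j
... | nothing = [] , broken
... | just t with move t e
...   | nothing = ((i , j , e) ∷ []) , broken
...   | just toBottom with follow G fuel (suc i) j fromTop
...     | vs , o = ((i , j , e) ∷ vs) , o
follow {n} G (suc fuel) i j e | just t | just toRight with suc j ℕ.≟ n
...     | yes _ = ((i , j , e) ∷ []) , exitsRight i
...     | no _ with follow G fuel i (suc j) fromLeft
...       | vs , o = ((i , j , e) ∷ vs) , o

-- The pipe starting at the top edge of column j (every step moves down or
-- right, so 2n steps of fuel suffice).
pipe : ∀ {n} → Grid n → Fin n → List Visit × Outcome
pipe {n} G j = follow G (n ℕ.+ n) 0 (toℕ j) fromTop

pipePath : ∀ {n} → Grid n → Fin n → List Visit
pipePath G j = Data.Product.proj₁ (pipe G j)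

pipeEnd : ∀ {n} → Grid n → Fin n → Outcome
pipeEnd G j = Data.Product.proj₂ (pipe G j)

Visits : ∀ {n} → Grid n → Fin n → Fin n → Fin n → Set
Visits G j a b = ∃[ e ] ((toℕ a , toℕ b , e) ∈ pipePath G j)

module _ {n : ℕ} (u : Permutation′ n) (G : Grid n) where

  private
    uu : Fin n → Fin n
    uu i = u ⟨$⟩ʳ i
    ui : Fin n → Fin n
    ui j = u ⟨$⟩ˡ j

  record IsRothe : Set where
    field
      pipesExit  : ∀ j → ∃[ r ] (pipeEnd G j ≡ exitsRight r)
      pivotTile  : ∀ i → G i (uu i) ≡ pivot
      emptyTile  : ∀ i j → ui j Fin.< i → j Fin.< uu i → G i j ≡ empty
      horizTile  : ∀ i j → ui j Fin.< i → uu i Fin.< j → G i j ≡ horizontal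
      vertTile   : ∀ i j → i Fin.< ui j → j Fin.< uu i → G i j ≡ vertical
      restTile   : ∀ i j → i Fin.< ui j → uu i Fin.< j → G i j ≡ cross ⊎ G i j ≡ elbow

CrossAt : ∀ {n} → Grid n → Fin n → Fin n → Fin n → Fin n → Set
CrossAt G j₁ j₂ a b = j₁ ≢ j₂ × G a b ≡ cross × Visits G j₁ a b × Visits G j₂ a b

TouchAt : ∀ {n} → Grid n → Fin n → Fin n → Fin n → Fin n → Set
TouchAt G j₁ j₂ a b = j₁ ≢ j₂ × G a b ≡ elbow × Visits G j₁ a b × Visits G j₂ a b

Reduced : ∀ {n} → Grid n → Set
Reduced G = ∀ j₁ j₂ a b a′ b′ → CrossAt G j₁ j₂ a b → CrossAt G j₁ j₂ a′ b′ →
            (a , b) ≡ (a′ , b′)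

HasExitPerm : ∀ {n} → Grid n → Permutation′ n → Set
HasExitPerm G v = ∀ i → pipeEnd G (v ⟨$⟩ʳ i) ≡ exitsRight (toℕ i)

NoTouchSE : ∀ {n} → Grid n → Set
NoTouchSE G = ∀ j₁ j₂ a b a′ b′ → CrossAt G j₁ j₂ a b → TouchAt G j₁ j₂ a′ b′ →
              ¬ (a Fin.< a′ × b Fin.< b′)

record IsFPP {n : ℕ} (u v : Permutation′ n) (G : Grid n) : Set where
  field
    rothe     : IsRothe u G
    reduced   : Reduced G
    exitPerm  : HasExitPerm G v
    noTouchSE : NoTouchSE G

restrict : ∀ {k n} → k ℕ.≤ n → Grid n → PGrid k n
restrict k≤n G i j = G (inject≤ i k≤n) j

Blocked : ∀ {k n} → PGrid k n → Fin n → Set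
Blocked D j = (∃[ i ] D i j ≡ pivot)
            ⊎ (∃[ i ] ∃[ j′ ] (D i j ≡ cross × j Fin.< j′ × D i j′ ≡ elbow))

UnblockedCol : ∀ {k n} → PGrid k n → Fin n → Set
UnblockedCol D j = ¬ Blocked D j

-- G with pivot columns u is the trivial completion of its first k rows:
-- u_{1} > ... > u_{k} and u_{k+1} > ... > u_{n} (0-indexed rows here).
DecreasingFirst : ∀ {n} → ℕ → Permutation′ n → Set
DecreasingFirst k u = ∀ i i′ → i Fin.< i′ → toℕ i′ ℕ.< k → (u ⟨$⟩ʳ i′) Fin.< (u ⟨$⟩ʳ i)

DecreasingRest : ∀ {n} → ℕ → Permutation′ n → Set
DecreasingRest k u = ∀ i i′ → k ℕ.≤ toℕ i → i Fin.< i′ → (u ⟨$⟩ʳ i′) Fin.< (u ⟨$⟩ʳ i)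

-- Decorated permutation π = v u⁻¹, i.e. π(u_i) = v_i.
decPerm : ∀ {n} → Permutation′ n → Permutation′ n → Fin n → Fin n
decPerm u v j = v ⟨$⟩ʳ (u ⟨$⟩ˡ j)

-- Position j is 2-coloured iff j ∈ {u_1, ..., u_k}, i.e. u⁻¹(j) is among the first k rows.
TwoColoured : ∀ {n} → ℕ → Permutation′ n → Fin n → Set
TwoColoured k u j = toℕ (u ⟨$⟩ˡ j) ℕ.< k

OneColoured : ∀ {n} → ℕ → Permutation′ n → Fin n → Set
OneColoured k u j = ¬ TwoColoured k u j

UnblockedPos : ∀ {n} → ℕ → Permutation′ n → Permutation′ n → Fin n → Set
UnblockedPos k u v j =
  OneColoured k u j ×
  (∀ j′ → j Fin.< j′ → OneColoured k u j′ → decPerm u v j Fin.< decPerm u v j′)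

{-# OPTIONS --safe #-}
module Submission where

-- Look at the labels (starting columns) of the pipes entering row k from above.  Below that
-- line G is the trivial completion: the pipe entering a 1-coloured column j falls straight to
-- its pivot in row u⁻¹(j) and leaves the array along that row, so it is the pipe π(j); no pipe
-- enters a 2-coloured column there.  So j is an unblocked position of π exactly when the pipe
-- entering row k at column j is smaller than every pipe entering to its right, and this is
-- proved row by row.  The local fact is that at a cross or an elbow the pipe coming from the
-- left is smaller than the one coming from the top: otherwise the two pipes crossed before,
-- contradicting reducedness, resp. the no-touch condition.  Hence the pipes from an unblocked
-- column rightwards stay increasing, while a cross with an elbow to its right sends a smaller
-- pipe past the column, and it stays to the right because the first k pivots decrease.

open import Defs
open import Data.Nat using (ℕ; zero; suc; _+_; _∸_; _<_; _≤_; z≤n; s≤s; _≟_; _<?_; s≤s⁻¹)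
open import Data.Nat.Properties
open import Data.Fin as Fin using (Fin; toℕ; fromℕ<)
import Data.Fin.Properties as Finₚ
open Finₚ using (toℕ<n; toℕ-fromℕ<; fromℕ<-toℕ; toℕ-injective; toℕ-inject≤)
open import Data.Fin.Permutation using (Permutation′; _⟨$⟩ʳ_; _⟨$⟩ˡ_; inverseˡ; inverseʳ)
open import Data.Maybe using (Maybe; just; nothing)
open import Data.Maybe.Properties using (just-injective)
open import Data.List using (List; []; _∷_; _++_; [_])
open import Data.List.Properties using (++-assoc)
open import Data.List.Membership.Propositional using (_∈_)
open import Data.List.Membership.Propositional.Properties using (∈-++⁺ʳ)
open import Data.List.Relation.Unary.Any using (here)
open import Data.Product using (_×_; _,_; ∃-syntax; proj₁; proj₂; map₁; uncurry)
open import Data.Sum using (_⊎_; inj₁; inj₂)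
open import Data.Empty using (⊥; ⊥-elim)
open import Function.Base using (_∘_; case_of_)
open import Function.Bundles using (_⇔_; mk⇔)
open import Relation.Nullary using (¬_; yes; no; contradiction)
open import Relation.Binary.Definitions using (tri<; tri≈; tri>)
open import Relation.Binary.PropositionalEquality hiding ([_])

module Tracing {n : ℕ} (G : Grid n) where

  tile : ℕ → ℕ → Maybe Tile
  tile = tileAt G

  Routes : ℕ → ℕ → Entry → Exit → Set
  Routes i c e d = ∃[ t ] (tile i c ≡ just t × move t e ≡ just d)

  data Reach (x : Fin n) : ℕ → ℕ → Entry → Set where
    start : ∀ {c} → toℕ x ≡ c → Reach x 0 c fromTop
    down  : ∀ {i c e} → Reach x i c e → Routes i c e toBottom → suc i < n →
            Reach x (suc i) c fromTop
    right : ∀ {i c e} → Reach x i c e → Routes i c e toRight → suc c < n →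
            Reach x i (suc c) fromLeft

  tile-inside : ∀ {i c} (p : i < n) (q : c < n) → tile i c ≡ just (G (fromℕ< p) (fromℕ< q))
  tile-inside {i} {c} p q with i <? n | c <? n
  ... | yes _ | yes _ = refl
  ... | yes _ | no c≮n = contradiction q c≮n
  ... | no i≮n | _ = contradiction p i≮n

  tile-Fin : (a b : Fin n) → tile (toℕ a) (toℕ b) ≡ just (G a b)
  tile-Fin a b = trans (tile-inside (toℕ<n a) (toℕ<n b))
                       (cong just (cong₂ G (fromℕ<-toℕ a _) (fromℕ<-toℕ b _)))

  tile-outside : ∀ {i c} → n ≤ i → tile i c ≡ nothing
  tile-outside {i} n≤i with i <? n
  ... | yes i<n = contradiction i<n (≤⇒≯ n≤i)
  ... | no _ = refl

  tile-bounded : ∀ {i c t} → tile i c ≡ just t → i < n × c < n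
  tile-bounded {i} {c} eq with i <? n | c <? n
  ... | yes p | yes q = p , q

  tile-unique : ∀ {i c t t′} → tile i c ≡ just t → tile i c ≡ just t′ → t ≡ t′
  tile-unique tile≡ tile≡′ = just-injective (trans (sym tile≡) tile≡′)

  Reach-bounded : ∀ {x i c e} → Reach x i c e → i < n × c < n
  Reach-bounded {x} (start refl) = ≤-<-trans z≤n (toℕ<n x) , toℕ<n x
  Reach-bounded (down r _ i<n)  = i<n , proj₂ (Reach-bounded r)
  Reach-bounded (right r _ c<n) = proj₁ (Reach-bounded r) , c<n

  follow-down : ∀ {f i c e} → Routes i c e toBottom →
    follow G (suc f) i c e ≡ map₁ ((i , c , e) ∷_) (follow G f (suc i) c fromTop)
  follow-down {f} {i} {c} {e} (t , tile≡ , move≡) with tileAt G i c | tile≡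
  ... | .(just t) | refl with move t e | move≡
  ... | .(just toBottom) | refl = refl

  follow-right : ∀ {f i c e} → Routes i c e toRight → suc c < n →
    follow G (suc f) i c e ≡ map₁ ((i , c , e) ∷_) (follow G f i (suc c) fromLeft)
  follow-right {f} {i} {c} {e} (t , tile≡ , move≡) c+1<n with tileAt G i c | tile≡
  ... | .(just t) | refl with move t e | move≡
  ... | .(just toRight) | refl with suc c ≟ n
  ... | yes c+1≡n = contradiction c+1≡n (<⇒≢ c+1<n)
  ... | no _ = refl

  follow-exit : ∀ {f i c e} → Routes i c e toRight → suc c ≡ n →
    proj₂ (follow G (suc f) i c e) ≡ exitsRight i
  follow-exit {f} {i} {c} {e} (t , tile≡ , move≡) c+1≡n with tileAt G i c | tile≡
  ... | .(just t) | refl with move t e | move≡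
  ... | .(just toRight) | refl with suc c ≟ n
  ... | yes _ = refl
  ... | no c+1≢n = contradiction c+1≡n c+1≢n

  follow-stuck : ∀ {f i c e t} → tile i c ≡ just t → move t e ≡ nothing →
    proj₂ (follow G (suc f) i c e) ≡ broken
  follow-stuck {f} {i} {c} {e} {t} tile≡ move≡ with tileAt G i c | tile≡
  ... | .(just t) | refl with move t e | move≡
  ... | .nothing | refl = refl

  follow-outside : ∀ {f i c e} → tile i c ≡ nothing → follow G f i c e ≡ ([] , broken)
  follow-outside {zero} _ = refl
  follow-outside {suc f} {i} {c} tile≡ with tileAt G i c | tile≡
  ... | .nothing | refl = refl

  follow-visits : ∀ {f i c e t} → tile i c ≡ just t → (i , c , e) ∈ proj₁ (follow G (suc f) i c e)
  follow-visits {f} {i} {c} {e} {t} tile≡ with tileAt G i c | tile≡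
  ... | .(just t) | refl with move t e
  ... | nothing = here refl
  ... | just toBottom = here refl
  ... | just toRight with suc c ≟ n
  ... | yes _ = here refl
  ... | no _ = here refl

  -- `pipe` starts at (0 , x) with fuel n + n; every step uses one unit of fuel and adds one to i + c.
  record OnTrace (x : Fin n) (i c : ℕ) (e : Entry) : Set where
    field
      fuel     : ℕ
      fuel+ic  : fuel + (i + c) ≡ n + n + toℕ x
      prefix   : List Visit
      path≡    : pipePath G x ≡ prefix ++ proj₁ (follow G fuel i c e)
      end≡     : pipeEnd G x ≡ proj₂ (follow G fuel i c e)

  fuel-positive : ∀ {f i c m} → i < n → c < n → f + (i + c) ≡ n + n + m → ∃[ f′ ] f ≡ suc f′
  fuel-positive {zero} i<n c<n eq =
    contradiction (≤-trans (+-mono-< i<n c<n) (m≤m+n _ _)) (<-irrefl eq)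
  fuel-positive {suc f} _ _ _ = f , refl

  OnTrace-step : ∀ {x i c e i′ c′ e′} →
    (∀ f → follow G (suc f) i c e ≡ map₁ ((i , c , e) ∷_) (follow G f i′ c′ e′)) →
    i′ + c′ ≡ suc (i + c) → i < n → c < n → OnTrace x i c e → OnTrace x i′ c′ e′
  OnTrace-step {x} {i} {c} {e} {i′} {c′} {e′} unfold ic′ i<n c<n
    record { fuel = fuel ; fuel+ic = fuel+ic ; prefix = pre ; path≡ = path≡ ; end≡ = end≡ }
    with fuel-positive {fuel} i<n c<n fuel+ic
  ... | f , refl = record
    { fuel    = f
    ; fuel+ic = trans (cong (f +_) ic′) (trans (+-suc f (i + c)) fuel+ic)
    ; prefix  = pre ++ [ i , c , e ]
    ; path≡   = begin
        pipePath G x                                          ≡⟨ path≡ ⟩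
        pre ++ proj₁ (follow G (suc f) i c e)                 ≡⟨ cong ((pre ++_) ∘ proj₁) (unfold f) ⟩
        pre ++ ((i , c , e) ∷ proj₁ (follow G f i′ c′ e′))   ≡⟨ ++-assoc pre _ _ ⟨
        (pre ++ [ i , c , e ]) ++ proj₁ (follow G f i′ c′ e′) ∎
    ; end≡    = trans end≡ (cong proj₂ (unfold f))
    }
    where open ≡-Reasoning

  Reach⇒OnTrace : ∀ {x i c e} → Reach x i c e → OnTrace x i c e
  Reach⇒OnTrace (start refl) = record
    { fuel = n + n ; fuel+ic = refl ; prefix = [] ; path≡ = refl ; end≡ = refl }
  Reach⇒OnTrace (down r routes _) =
    OnTrace-step (λ _ → follow-down routes) refl
      (proj₁ (Reach-bounded r)) (proj₂ (Reach-bounded r)) (Reach⇒OnTrace r)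
  Reach⇒OnTrace (right {i} {c} r routes c+1<n) =
    OnTrace-step (λ _ → follow-right routes c+1<n) (+-suc i c)
      (proj₁ (Reach-bounded r)) (proj₂ (Reach-bounded r)) (Reach⇒OnTrace r)

  Reach⇒suffix : ∀ {x i c e} → Reach x i c e → ∃[ f ] ∃[ pre ]
    (pipePath G x ≡ pre ++ proj₁ (follow G (suc f) i c e) ×
     pipeEnd G x ≡ proj₂ (follow G (suc f) i c e))
  Reach⇒suffix r with Reach⇒OnTrace r | Reach-bounded r
  ... | record { fuel = fuel ; fuel+ic = fuel+ic ; prefix = pre ; path≡ = path≡ ; end≡ = end≡ }
      | i<n , c<n
    with fuel-positive {fuel} i<n c<n fuel+ic
  ... | f , refl = f , pre , path≡ , end≡

  Reach⇒visits : ∀ {x i c e} → Reach x i c e → (i , c , e) ∈ pipePath G x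
  Reach⇒visits r with Reach⇒suffix r | Reach-bounded r
  ... | f , pre , path≡ , _ | i<n , c<n =
    subst (_ ∈_) (sym path≡) (∈-++⁺ʳ pre (follow-visits (tile-inside i<n c<n)))

  Reach⇒exitsRight : ∀ {x i c e} → Reach x i c e → Routes i c e toRight → suc c ≡ n →
                     pipeEnd G x ≡ exitsRight i
  Reach⇒exitsRight r routes c+1≡n with Reach⇒suffix r
  ... | f , _ , _ , end≡ = trans end≡ (follow-exit routes c+1≡n)

  Reach⇒stuck : ∀ {x i c e t} → Reach x i c e → tile i c ≡ just t → move t e ≡ nothing →
                pipeEnd G x ≡ broken
  Reach⇒stuck r tile≡ move≡ with Reach⇒suffix r
  ... | f , _ , _ , end≡ = trans end≡ (follow-stuck tile≡ move≡)

  Reach⇒fallsOff : ∀ {x i c e} → Reach x i c e → Routes i c e toBottom → suc i ≡ n →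
                   pipeEnd G x ≡ broken
  Reach⇒fallsOff {x} {i} {c} {e} r routes i+1≡n with Reach⇒suffix r
  ... | f , _ , _ , end≡ = begin
    pipeEnd G x                           ≡⟨ end≡ ⟩
    proj₂ (follow G (suc f) i c e)        ≡⟨ cong proj₂ (follow-down routes) ⟩
    proj₂ (follow G f (suc i) c fromTop)  ≡⟨ cong proj₂ (follow-outside {f} below-last-row) ⟩
    broken                                ∎
    where
    open ≡-Reasoning
    below-last-row : tile (suc i) c ≡ nothing
    below-last-row = tile-outside (≤-reflexive (sym i+1≡n))

  straight-down : ∀ {x i c r} → Reach x i c fromTop → i ≤ r → r < n →
                  (∀ i′ → i ≤ i′ → i′ < r → tile i′ c ≡ just vertical) → Reach x r c fromTop
  straight-down {r = zero} r₀ z≤n _ _ = r₀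
  straight-down {x} {i} {c} {suc r} r₀ i≤r+1 r+1<n verticals with m≤n⇒m<n∨m≡n i≤r+1
  ... | inj₂ refl = r₀
  ... | inj₁ i≤r  = down (straight-down r₀ (s≤s⁻¹ i≤r) (<-trans (n<1+n r) r+1<n) verticals-above)
                         (vertical , verticals r (s≤s⁻¹ i≤r) ≤-refl , refl) r+1<n
    where
    verticals-above : ∀ i′ → i ≤ i′ → i′ < r → tile i′ c ≡ just vertical
    verticals-above i′ i≤i′ i′<r = verticals i′ i≤i′ (m<n⇒m<1+n i′<r)

  exits-along-row : ∀ {x i c e} → Reach x i c e → Routes i c e toRight →
                    (∀ d → c < d → d < n → tile i d ≡ just horizontal) → pipeEnd G x ≡ exitsRight i
  exits-along-row {c = c} r routes horizontals =
    go (n ∸ suc c) (m∸n+n≡m (proj₂ (Reach-bounded r))) r routes horizontals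
    where
    go : ∀ gap {x i c e} → gap + suc c ≡ n → Reach x i c e → Routes i c e toRight →
         (∀ d → c < d → d < n → tile i d ≡ just horizontal) → pipeEnd G x ≡ exitsRight i
    go zero      eq r routes _ = Reach⇒exitsRight r routes eq
    go (suc gap) {c = c} eq r routes horizontals =
      go gap (trans (+-suc gap (suc c)) eq) (right r routes c+1<n)
        (horizontal , horizontals (suc c) ≤-refl c+1<n , refl)
        (λ d c+1<d → horizontals d (<-trans (n<1+n c) c+1<d))
      where
      c+1<n : suc c < n
      c+1<n = subst (suc c <_) eq (s≤s (m≤n+m (suc c) gap))

  move-injective : ∀ {t e e′ d} → move t e ≡ just d → move t e′ ≡ just d → e ≡ e′
  move-injective {e = fromTop}  {fromTop}  _ _ = refl
  move-injective {e = fromLeft} {fromLeft} _ _ = refl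
  move-injective {cross}      {fromTop}  {fromLeft} refl ()
  move-injective {cross}      {fromLeft} {fromTop}  refl ()
  move-injective {elbow}      {fromTop}  {fromLeft} refl ()
  move-injective {elbow}      {fromLeft} {fromTop}  refl ()
  move-injective {empty}      {fromTop}  {fromLeft} ()
  move-injective {empty}      {fromLeft} {fromTop}  ()
  move-injective {horizontal} {fromTop}  {fromLeft} ()
  move-injective {horizontal} {fromLeft} {fromTop}  _ ()
  move-injective {vertical}   {fromTop}  {fromLeft} _ ()
  move-injective {vertical}   {fromLeft} {fromTop}  ()
  move-injective {pivot}      {fromTop}  {fromLeft} _ ()
  move-injective {pivot}      {fromLeft} {fromTop}  ()

  Routes-functional : ∀ {i c e d d′} → Routes i c e d → Routes i c e d′ → d ≡ d′
  Routes-functional (t , tile≡ , move≡) (_ , tile≡′ , move≡′)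
    with just-injective (trans (sym tile≡) tile≡′)
  ... | refl = just-injective (trans (sym move≡) move≡′)

  Routes-injective : ∀ {i c e e′ d} → Routes i c e d → Routes i c e′ d → e ≡ e′
  Routes-injective (t , tile≡ , move≡) (_ , tile≡′ , move≡′)
    with just-injective (trans (sym tile≡) tile≡′)
  ... | refl = move-injective move≡ move≡′

  Routes⇒cross : ∀ {i c} → Routes i c fromTop toBottom → Routes i c fromLeft toRight →
                 tile i c ≡ just cross
  Routes⇒cross (t , tile≡ , move≡) (_ , tile≡′ , move≡′)
    with just-injective (trans (sym tile≡) tile≡′)
  ... | refl = trans tile≡ (cong just (both-arcs t move≡ move≡′))
    where
    both-arcs : ∀ t → move t fromTop ≡ just toBottom → move t fromLeft ≡ just toRight → t ≡ cross
    both-arcs cross      _ _ = refl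
    both-arcs vertical   _ ()
    both-arcs elbow      () _
    both-arcs empty      () _
    both-arcs horizontal () _
    both-arcs pivot      () _

  elbow-routes : ∀ {i c} → tile i c ≡ just elbow → Routes i c fromLeft toBottom
  elbow-routes tile≡ = elbow , tile≡ , refl

  Routes⇒elbow : ∀ {i c} → Routes i c fromLeft toBottom → tile i c ≡ just elbow
  Routes⇒elbow (elbow , tile≡ , _) = tile≡
  Routes⇒elbow (empty , _ , ())
  Routes⇒elbow (horizontal , _ , ())
  Routes⇒elbow (vertical , _ , ())
  Routes⇒elbow (pivot , _ , ())
  Routes⇒elbow (cross , _ , ())

  turns-and-descends : ∀ {i c e} → Routes i c e toRight → Routes i c e toBottom → ⊥
  turns-and-descends r r′ with Routes-functional r r′
  ... | ()

  turn-tile : ∀ {i c} → Routes i c fromTop toRight → tile i c ≡ just pivot ⊎ tile i c ≡ just elbow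
  turn-tile (pivot , tile≡ , _)    = inj₁ tile≡
  turn-tile (elbow , tile≡ , _)    = inj₂ tile≡
  turn-tile (empty , _ , ())
  turn-tile (horizontal , _ , ())
  turn-tile (vertical , _ , ())
  turn-tile (cross , _ , ())

  Reach-injective : ∀ {x y i c e} → Reach x i c e → Reach y i c e → x ≡ y
  Reach-injective (start p) (start q) = toℕ-injective (trans p (sym q))
  Reach-injective (down r routes _) (down r′ routes′ _)
    with Routes-injective routes routes′
  ... | refl = Reach-injective r r′
  Reach-injective (right r routes _) (right r′ routes′ _)
    with Routes-injective routes routes′
  ... | refl = Reach-injective r r′

  record Run (x : Fin n) (i c : ℕ) : Set where
    field
      from    : ℕ
      from<c  : from < c
      entered : Reach x i from fromTop
      turned  : Routes i from fromTop toRight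
      reaches : ∀ d → from < d → d ≤ c → Reach x i d fromLeft
      passes  : ∀ d → from < d → d < c → Routes i d fromLeft toRight

  run : ∀ {x i c} → Reach x i c fromLeft → Run x i c
  run {x} {i} r@(right {c = c} {fromTop} r₀ routes _) = record
    { from = c ; from<c = ≤-refl ; entered = r₀ ; turned = routes
    ; reaches = λ d c<d d≤c+1 → subst (λ z → Reach x i z fromLeft) (≤-antisym c<d d≤c+1) r
    ; passes  = λ d c<d d<c+1 → contradiction (s≤s⁻¹ d<c+1) (<⇒≱ c<d)
    }
  run {x} {i} r@(right {c = c} {fromLeft} r₀ routes _) = record
    { from = from ; from<c = m<n⇒m<1+n from<c ; entered = entered ; turned = turned
    ; reaches = reaches′ ; passes = passes′
    }
    where
    open Run (run r₀)
    reaches′ : ∀ d → from < d → d ≤ suc c → Reach x i d fromLeft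
    reaches′ d from<d d≤c+1 with m≤n⇒m<n∨m≡n d≤c+1
    ... | inj₁ d<c+1 = reaches d from<d (s≤s⁻¹ d<c+1)
    ... | inj₂ refl  = r
    passes′ : ∀ d → from < d → d < suc c → Routes i d fromLeft toRight
    passes′ d from<d d<c+1 with m≤n⇒m<n∨m≡n (s≤s⁻¹ d<c+1)
    ... | inj₁ d<c = passes d from<d d<c
    ... | inj₂ refl = routes

  Run⇒Reach : ∀ {x i c} → Run x i c → Reach x i c fromLeft
  Run⇒Reach R = Run.reaches R _ (Run.from<c R) ≤-refl

  data Descent (x : Fin n) (i c : ℕ) : Set where
    straight : Reach x i c fromTop → Routes i c fromTop toBottom → Descent x i c
    turning  : Run x i c → tile i c ≡ just elbow → Descent x i c

  descent : ∀ {x i c} → Reach x (suc i) c fromTop → Descent x i c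
  descent (down {e = fromTop}  r routes _) = straight r routes
  descent (down {e = fromLeft} r routes _) = turning (run r) (Routes⇒elbow routes)

  entry-column-unique : ∀ {x i c c′} → Reach x i c fromTop → Reach x i c′ fromTop → c ≡ c′
  entry-column-unique (start refl) (start refl) = refl
  entry-column-unique {i = suc i} {c} {c′} r r′ with descent r | descent r′
  ... | straight a _ | straight b _ = entry-column-unique a b
  ... | straight a down-a | turning R _
    with entry-column-unique a (Run.entered R)
  ...   | refl = ⊥-elim (turns-and-descends (Run.turned R) down-a)
  entry-column-unique {i = suc i} {c} {c′} r r′ | turning R _ | straight b down-b
    with entry-column-unique b (Run.entered R)
  ...   | refl = ⊥-elim (turns-and-descends (Run.turned R) down-b)
  entry-column-unique {i = suc i} {c} {c′} r r′ | turning R elbow-c | turning R′ elbow-c′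
    with entry-column-unique (Run.entered R) (Run.entered R′) | <-cmp c c′
  ... | _    | tri≈ _ c≡c′ _ = c≡c′
  ... | from≡ | tri< c<c′ _ _ = ⊥-elim (turns-and-descends
          (Run.passes R′ c (subst (_< c) from≡ (Run.from<c R)) c<c′) (elbow-routes elbow-c))
  ... | from≡ | tri> _ _ c′<c = ⊥-elim (turns-and-descends
          (Run.passes R c′ (subst (_< c′) (sym from≡) (Run.from<c R′)) c′<c) (elbow-routes elbow-c′))

  record CrossingAt (x y : Fin n) (i c : ℕ) : Set where
    field
      is-cross : tile i c ≡ just cross
      reach₁   : ∃[ e ] Reach x i c e
      reach₂   : ∃[ e ] Reach y i c e

  CrossedAbove : Fin n → Fin n → ℕ → ℕ → Set
  CrossedAbove x y i c = ∃[ i₀ ] ∃[ c₀ ] (i₀ < i × c₀ ≤ c × CrossingAt x y i₀ c₀)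

  CrossedAbove-weaken : ∀ {x y i c c′} → c ≤ c′ → CrossedAbove x y i c →
                        CrossedAbove x y (suc i) c′
  CrossedAbove-weaken c≤c′ (i₀ , c₀ , i₀<i , c₀≤c , X) =
    i₀ , c₀ , m<n⇒m<1+n i₀<i , ≤-trans c₀≤c c≤c′ , X

  -- Pipes enter the top row in increasing order, so two pipes found in the wrong order
  -- must have crossed on the way.
  crossed-above : ∀ {x y i c c′} → Reach x i c fromTop → Reach y i c′ fromTop → c < c′ →
                  y Fin.< x → CrossedAbove x y i c
  crossed-above (start refl) (start refl) c<c′ y<x = contradiction c<c′ (<⇒≯ y<x)
  crossed-above {x} {y} {suc i} {c} {c′} r r′ c<c′ y<x with descent r | descent r′
  ... | straight a _ | straight b _ = CrossedAbove-weaken ≤-refl (crossed-above a b c<c′ y<x)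
  ... | turning R _ | straight b _ =
    CrossedAbove-weaken (<⇒≤ from<c) (crossed-above entered b (<-trans from<c c<c′) y<x)
    where open Run R
  ... | straight a down-a | turning R _ with <-cmp (Run.from R) c
  ...   | tri< from<c _ _ = i , c , ≤-refl , ≤-refl , crossing
    where
    crossing : CrossingAt x y i c
    crossing = record
      { is-cross = Routes⇒cross down-a (Run.passes R c from<c c<c′)
      ; reach₁   = fromTop , a
      ; reach₂   = fromLeft , Run.reaches R c from<c (<⇒≤ c<c′)
      }
  ...   | tri≈ _ refl _ = contradiction (Reach-injective a (Run.entered R)) x≢y
    where
    x≢y : x ≢ y
    x≢y = ≢-sym (Finₚ.<⇒≢ y<x)
  ...   | tri> _ _ c<from = CrossedAbove-weaken ≤-refl (crossed-above a (Run.entered R) c<from y<x)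
  crossed-above {x} {y} {suc i} {c} {c′} r r′ c<c′ y<x | turning R _ | turning R′ _
    with <-cmp (Run.from R) (Run.from R′)
  ... | tri< from<from′ _ _ =
    CrossedAbove-weaken (<⇒≤ (Run.from<c R))
      (crossed-above (Run.entered R) (Run.entered R′) from<from′ y<x)
  ... | tri≈ _ from≡from′ _ = contradiction (Reach-injective (Run.entered R) entered′) x≢y
    where
    entered′ : Reach y i (Run.from R) fromTop
    entered′ = subst (λ d → Reach y i d fromTop) (sym from≡from′) (Run.entered R′)
    x≢y : x ≢ y
    x≢y = ≢-sym (Finₚ.<⇒≢ y<x)
  ... | tri> _ _ from′<from = case Routes-injective passes-from (Run.turned R) of λ ()
    where
    passes-from : Routes i (Run.from R) fromLeft toRight
    passes-from = Run.passes R′ (Run.from R) from′<from (<-trans (Run.from<c R) c<c′)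

module Meetings {n : ℕ} (G : Grid n) where
  open Tracing G

  Reach⇒Visits : ∀ {x i c e} → Reach x i c e → (p : i < n) (q : c < n) →
                 Visits G x (fromℕ< p) (fromℕ< q)
  Reach⇒Visits {x} {e = e} r p q =
    e , subst₂ (λ a b → (a , b , e) ∈ pipePath G x)
               (sym (toℕ-fromℕ< p)) (sym (toℕ-fromℕ< q)) (Reach⇒visits r)

  CrossingAt⇒CrossAt : ∀ {x y i c} → x ≢ y → CrossingAt x y i c → (p : i < n) (q : c < n) →
                       CrossAt G x y (fromℕ< p) (fromℕ< q)
  CrossingAt⇒CrossAt x≢y X p q =
    x≢y , just-injective (trans (sym (tile-inside p q)) is-cross) ,
    Reach⇒Visits (proj₂ reach₁) p q , Reach⇒Visits (proj₂ reach₂) p q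
    where open CrossingAt X

  crossings-in-same-row : Reduced G → ∀ {x y i c i′ c′} → x ≢ y →
                          CrossingAt x y i c → CrossingAt x y i′ c′ → i ≡ i′
  crossings-in-same-row reduced x≢y X X′ =
    let p , q = tile-bounded (CrossingAt.is-cross X)
        p′ , q′ = tile-bounded (CrossingAt.is-cross X′)
        same = reduced _ _ _ _ _ _ (CrossingAt⇒CrossAt x≢y X p q) (CrossingAt⇒CrossAt x≢y X′ p′ q′)
    in trans (sym (toℕ-fromℕ< p)) (trans (cong (toℕ ∘ proj₁) same) (toℕ-fromℕ< p′))

  meeting : ∀ {h x i c} → Reach h i c fromLeft → Reach x i c fromTop →
            h Fin.< x ⊎ (h ≢ x × ∃[ i₀ ] ∃[ c₀ ] (i₀ < i × c₀ < c × CrossingAt h x i₀ c₀))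
  meeting {h} {x} rh rx with run rh | Finₚ.<-cmp h x
  ... | _ | tri< h<x _ _ = inj₁ h<x
  ... | R | tri≈ _ refl _ = contradiction (entry-column-unique (Run.entered R) rx) (<⇒≢ (Run.from<c R))
  ... | R | tri> _ _ x<h with crossed-above (Run.entered R) rx (Run.from<c R) x<h
  ...   | i₀ , c₀ , i₀<i , c₀≤from , X =
          inj₂ (≢-sym (Finₚ.<⇒≢ x<h) , i₀ , c₀ , i₀<i , ≤-<-trans c₀≤from (Run.from<c R) , X)

  left<top-at-cross : Reduced G → ∀ {h x i c} → tile i c ≡ just cross →
                      Reach h i c fromLeft → Reach x i c fromTop → h Fin.< x
  left<top-at-cross reduced {h} {x} {i} {c} tile≡ rh rx with meeting rh rx
  ... | inj₁ h<x = h<x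
  ... | inj₂ (h≢x , _ , _ , i₀<i , _ , X) =
    contradiction (crossings-in-same-row reduced h≢x X crossing-here) (<⇒≢ i₀<i)
    where
    crossing-here : CrossingAt h x i c
    crossing-here = record { is-cross = tile≡ ; reach₁ = _ , rh ; reach₂ = _ , rx }

  left<top-at-elbow : NoTouchSE G → ∀ {h x i c} → tile i c ≡ just elbow →
                      Reach h i c fromLeft → Reach x i c fromTop → h Fin.< x
  left<top-at-elbow noTouchSE {h} {x} {i} {c} tile≡ rh rx with meeting rh rx
  ... | inj₁ h<x = h<x
  ... | inj₂ (h≢x , i₀ , c₀ , i₀<i , c₀<c , X) =
    ⊥-elim (noTouchSE _ _ _ _ _ _ (CrossingAt⇒CrossAt h≢x X p₀ q₀) touch
             (subst₂ _<_ (sym (toℕ-fromℕ< p₀)) (sym (toℕ-fromℕ< p)) i₀<i ,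
              subst₂ _<_ (sym (toℕ-fromℕ< q₀)) (sym (toℕ-fromℕ< q)) c₀<c))
    where
    p₀ : i₀ < n
    p₀ = proj₁ (tile-bounded (CrossingAt.is-cross X))
    q₀ : c₀ < n
    q₀ = proj₂ (tile-bounded (CrossingAt.is-cross X))
    p : i < n
    p = proj₁ (tile-bounded tile≡)
    q : c < n
    q = proj₂ (tile-bounded tile≡)
    touch : TouchAt G h x (fromℕ< p) (fromℕ< q)
    touch = h≢x , just-injective (trans (sym (tile-inside p q)) tile≡) ,
            Reach⇒Visits rh p q , Reach⇒Visits rx p q

module RotheShape {n : ℕ} (u : Permutation′ n) (G : Grid n) (rothe : IsRothe u G) where
  open Tracing G
  open IsRothe rothe

  -- u and u⁻¹ on ℕ-coordinates, with the junk value 0 outside the array.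
  pivotCol : ℕ → ℕ
  pivotCol i with i <? n
  ... | yes p = toℕ (u ⟨$⟩ʳ fromℕ< p)
  ... | no _  = 0

  pivotRow : ℕ → ℕ
  pivotRow c with c <? n
  ... | yes q = toℕ (u ⟨$⟩ˡ fromℕ< q)
  ... | no _  = 0

  pivotCol-inside : ∀ {i} (p : i < n) → pivotCol i ≡ toℕ (u ⟨$⟩ʳ fromℕ< p)
  pivotCol-inside {i} p with i <? n
  ... | yes _   = refl
  ... | no i≮n  = contradiction p i≮n

  pivotRow-inside : ∀ {c} (q : c < n) → pivotRow c ≡ toℕ (u ⟨$⟩ˡ fromℕ< q)
  pivotRow-inside {c} q with c <? n
  ... | yes _   = refl
  ... | no c≮n  = contradiction q c≮n

  pivotCol<n : ∀ {i} → i < n → pivotCol i < n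
  pivotCol<n p = subst (_< n) (sym (pivotCol-inside p)) (toℕ<n _)

  pivotRow<n : ∀ {c} → c < n → pivotRow c < n
  pivotRow<n q = subst (_< n) (sym (pivotRow-inside q)) (toℕ<n _)

  fromℕ<-pivotCol : ∀ {i} (p : i < n) → fromℕ< (pivotCol<n p) ≡ u ⟨$⟩ʳ fromℕ< p
  fromℕ<-pivotCol p = toℕ-injective (trans (toℕ-fromℕ< _) (pivotCol-inside p))

  pivot-tile : ∀ {i} → i < n → tile i (pivotCol i) ≡ just pivot
  pivot-tile p =
    trans (tile-inside p (pivotCol<n p)) (cong just (trans (cong (G _) (fromℕ<-pivotCol p)) (pivotTile _)))

  pivotRow-pivotCol : ∀ {i} → i < n → pivotRow (pivotCol i) ≡ i
  pivotRow-pivotCol {i} p = begin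
    pivotRow (pivotCol i)                 ≡⟨ pivotRow-inside (pivotCol<n p) ⟩
    toℕ (u ⟨$⟩ˡ fromℕ< (pivotCol<n p))    ≡⟨ cong (λ a → toℕ (u ⟨$⟩ˡ a)) (fromℕ<-pivotCol p) ⟩
    toℕ (u ⟨$⟩ˡ (u ⟨$⟩ʳ fromℕ< p))        ≡⟨ cong toℕ (inverseˡ u) ⟩
    toℕ (fromℕ< p)                        ≡⟨ toℕ-fromℕ< p ⟩
    i                                     ∎
    where open ≡-Reasoning

  pivotCol-pivotRow : ∀ {c} → c < n → pivotCol (pivotRow c) ≡ c
  pivotCol-pivotRow {c} q = begin
    pivotCol (pivotRow c)                 ≡⟨ pivotCol-inside (pivotRow<n q) ⟩
    toℕ (u ⟨$⟩ʳ fromℕ< (pivotRow<n q))    ≡⟨ cong (λ a → toℕ (u ⟨$⟩ʳ a)) fromℕ<-pivotRow ⟩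
    toℕ (u ⟨$⟩ʳ (u ⟨$⟩ˡ fromℕ< q))        ≡⟨ cong toℕ (inverseʳ u) ⟩
    toℕ (fromℕ< q)                        ≡⟨ toℕ-fromℕ< q ⟩
    c                                     ∎
    where
    open ≡-Reasoning
    fromℕ<-pivotRow : fromℕ< (pivotRow<n q) ≡ u ⟨$⟩ˡ fromℕ< q
    fromℕ<-pivotRow = toℕ-injective (trans (toℕ-fromℕ< _) (pivotRow-inside q))

  pivotRow≡⇒pivotCol≡ : ∀ {i c} → c < n → pivotRow c ≡ i → c ≡ pivotCol i
  pivotRow≡⇒pivotCol≡ q r≡ = trans (sym (pivotCol-pivotRow q)) (cong pivotCol r≡)

  data Shape (i c : ℕ) : Set where
    at-pivot   : c ≡ pivotCol i → tile i c ≡ just pivot → Shape i c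
    empty-zone : c < pivotCol i → pivotRow c < i → tile i c ≡ just empty → Shape i c
    vert-zone  : c < pivotCol i → i < pivotRow c → tile i c ≡ just vertical → Shape i c
    horiz-zone : pivotCol i < c → pivotRow c < i → tile i c ≡ just horizontal → Shape i c
    free-zone  : pivotCol i < c → i < pivotRow c →
                 tile i c ≡ just cross ⊎ tile i c ≡ just elbow → Shape i c

  module _ {i c : ℕ} (p : i < n) (q : c < n) where
    private
      I C : Fin n
      I = fromℕ< p
      C = fromℕ< q

      col< : c < pivotCol i → C Fin.< u ⟨$⟩ʳ I
      col< = subst₂ _<_ (sym (toℕ-fromℕ< q)) (pivotCol-inside p)

      col> : pivotCol i < c → u ⟨$⟩ʳ I Fin.< C
      col> = subst₂ _<_ (pivotCol-inside p) (sym (toℕ-fromℕ< q))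

      row< : i < pivotRow c → I Fin.< u ⟨$⟩ˡ C
      row< = subst₂ _<_ (sym (toℕ-fromℕ< p)) (pivotRow-inside q)

      row> : pivotRow c < i → u ⟨$⟩ˡ C Fin.< I
      row> = subst₂ _<_ (pivotRow-inside q) (sym (toℕ-fromℕ< p))

      in-zone : ∀ {t} → G I C ≡ t → tile i c ≡ just t
      in-zone eq = trans (tile-inside p q) (cong just eq)

    shape : Shape i c
    shape with <-cmp c (pivotCol i) | <-cmp (pivotRow c) i
    ... | tri≈ _ refl _ | _ = at-pivot refl (pivot-tile p)
    ... | tri< c< _ _ | tri≈ _ r≡ _ = contradiction (pivotRow≡⇒pivotCol≡ q r≡) (<⇒≢ c<)
    ... | tri> _ _ c> | tri≈ _ r≡ _ = contradiction (pivotRow≡⇒pivotCol≡ q r≡) (>⇒≢ c>)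
    ... | tri< c< _ _ | tri< r< _ _ = empty-zone c< r< (in-zone (emptyTile I C (row> r<) (col< c<)))
    ... | tri< c< _ _ | tri> _ _ r> = vert-zone c< r> (in-zone (vertTile I C (row< r>) (col< c<)))
    ... | tri> _ _ c> | tri< r< _ _ = horiz-zone c> r< (in-zone (horizTile I C (row> r<) (col> c>)))
    ... | tri> _ _ c> | tri> _ _ r> with restTile I C (row< r>) (col> c>)
    ...   | inj₁ is-cross = free-zone c> r> (inj₁ (in-zone is-cross))
    ...   | inj₂ is-elbow = free-zone c> r> (inj₂ (in-zone is-elbow))

  vertical-zone : ∀ {i c} → i < n → c < n → c < pivotCol i → i < pivotRow c →
                  tile i c ≡ just vertical
  vertical-zone p q c< r> with shape p q
  ... | vert-zone _ _ t≡  = t≡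
  ... | at-pivot c≡ _     = contradiction c≡ (<⇒≢ c<)
  ... | empty-zone _ r< _ = contradiction r> (<⇒≯ r<)
  ... | horiz-zone c> _ _ = contradiction c> (<⇒≯ c<)
  ... | free-zone c> _ _  = contradiction c> (<⇒≯ c<)

  horizontal-zone : ∀ {i c} → i < n → c < n → pivotCol i < c → pivotRow c < i →
                    tile i c ≡ just horizontal
  horizontal-zone p q c> r< with shape p q
  ... | horiz-zone _ _ t≡ = t≡
  ... | at-pivot c≡ _     = contradiction c≡ (>⇒≢ c>)
  ... | empty-zone c< _ _ = contradiction c> (<⇒≯ c<)
  ... | vert-zone c< _ _  = contradiction c> (<⇒≯ c<)
  ... | free-zone _ r> _  = contradiction r> (<⇒≯ r<)

  FreeZone : ℕ → ℕ → Set
  FreeZone i c = pivotCol i < c × i < pivotRow c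

  FreeZone-of : ∀ {i c t} → tile i c ≡ just t →
                t ≢ empty → t ≢ vertical → t ≢ horizontal → t ≢ pivot → FreeZone i c
  FreeZone-of tile≡ ≢e ≢v ≢h ≢p with uncurry shape (tile-bounded tile≡)
  ... | at-pivot _ t≡     = contradiction (tile-unique tile≡ t≡) ≢p
  ... | empty-zone _ _ t≡ = contradiction (tile-unique tile≡ t≡) ≢e
  ... | vert-zone _ _ t≡  = contradiction (tile-unique tile≡ t≡) ≢v
  ... | horiz-zone _ _ t≡ = contradiction (tile-unique tile≡ t≡) ≢h
  ... | free-zone c> r> _ = c> , r>

  cross⇒FreeZone : ∀ {i c} → tile i c ≡ just cross → FreeZone i c
  cross⇒FreeZone tile≡ = FreeZone-of tile≡ (λ ()) (λ ()) (λ ()) (λ ())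

  elbow⇒FreeZone : ∀ {i c} → tile i c ≡ just elbow → FreeZone i c
  elbow⇒FreeZone tile≡ = FreeZone-of tile≡ (λ ()) (λ ()) (λ ()) (λ ())

  pivot⇒pivotCol : ∀ {i c} → tile i c ≡ just pivot → c ≡ pivotCol i
  pivot⇒pivotCol tile≡ with uncurry shape (tile-bounded tile≡)
  ... | at-pivot c≡ _            = c≡
  ... | empty-zone _ _ t≡        = contradiction (tile-unique tile≡ t≡) λ ()
  ... | vert-zone _ _ t≡         = contradiction (tile-unique tile≡ t≡) λ ()
  ... | horiz-zone _ _ t≡        = contradiction (tile-unique tile≡ t≡) λ ()
  ... | free-zone _ _ (inj₁ t≡)  = contradiction (tile-unique tile≡ t≡) λ ()
  ... | free-zone _ _ (inj₂ t≡)  = contradiction (tile-unique tile≡ t≡) λ ()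

  data RightOfPivot (i c : ℕ) : Set where
    horizontal-tile : tile i c ≡ just horizontal → RightOfPivot i c
    cross-tile      : tile i c ≡ just cross → RightOfPivot i c
    elbow-tile      : tile i c ≡ just elbow → RightOfPivot i c

  right-of-pivot : ∀ {i c} → i < n → c < n → pivotCol i < c → RightOfPivot i c
  right-of-pivot p q c> with shape p q
  ... | at-pivot c≡ _            = contradiction (sym c≡) (<⇒≢ c>)
  ... | empty-zone c< _ _        = contradiction c> (<⇒≯ c<)
  ... | vert-zone c< _ _         = contradiction c> (<⇒≯ c<)
  ... | horiz-zone _ _ t≡        = horizontal-tile t≡
  ... | free-zone _ _ (inj₁ t≡)  = cross-tile t≡
  ... | free-zone _ _ (inj₂ t≡)  = elbow-tile t≡

  mutual
    pipe-from-above : ∀ {i c} → i < n → c < n → i ≤ pivotRow c → ∃[ x ] Reach x i c fromTop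
    pipe-from-above {zero} _ q _ = fromℕ< q , start (toℕ-fromℕ< q)
    pipe-from-above {suc i} {c} p q i<r with shape (<⇒≤ p) q
    ... | at-pivot c≡ _ = contradiction (subst (suc i ≤_) r≡i i<r) (n≮n i)
      where
      r≡i : pivotRow c ≡ i
      r≡i = trans (cong pivotRow c≡) (pivotRow-pivotCol (<⇒≤ p))
    ... | empty-zone _ r< _ = contradiction r< (≤⇒≯ (<⇒≤ i<r))
    ... | horiz-zone _ r< _ = contradiction r< (≤⇒≯ (<⇒≤ i<r))
    ... | vert-zone _ _ t≡ =
      let x , r = pipe-from-above (<⇒≤ p) q (<⇒≤ i<r) in x , down r (vertical , t≡ , refl) p
    ... | free-zone _ _ (inj₁ t≡) =
      let x , r = pipe-from-above (<⇒≤ p) q (<⇒≤ i<r) in x , down r (cross , t≡ , refl) p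
    ... | free-zone c> _ (inj₂ t≡) =
      let x , r = pipe-from-left (<⇒≤ p) q c> in x , down r (elbow , t≡ , refl) p

    pipe-from-left : ∀ {i c} → i < n → c < n → pivotCol i < c → ∃[ x ] Reach x i c fromLeft
    pipe-from-left {i} {suc c} p q c> with m≤n⇒m<n∨m≡n (s≤s⁻¹ c>)
    ... | inj₂ c≡ =
      let x , r = pipe-from-above p (<⇒≤ q) (≤-reflexive (sym r≡i))
      in x , right r (pivot , subst (λ d → tile i d ≡ just pivot) c≡ (pivot-tile p) , refl) q
      where
      r≡i : pivotRow c ≡ i
      r≡i = trans (cong pivotRow (sym c≡)) (pivotRow-pivotCol p)
    ... | inj₁ c>′ with right-of-pivot p (<⇒≤ q) c>′
    ...   | horizontal-tile t≡ =
      let x , r = pipe-from-left p (<⇒≤ q) c>′ in x , right r (horizontal , t≡ , refl) q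
    ...   | cross-tile t≡ =
      let x , r = pipe-from-left p (<⇒≤ q) c>′ in x , right r (cross , t≡ , refl) q
    ...   | elbow-tile t≡ =
      let x , r = pipe-from-above p (<⇒≤ q) (<⇒≤ (proj₂ (elbow⇒FreeZone t≡)))
      in x , right r (elbow , t≡ , refl) q

  elbow-fed-from-above : ∀ {i c} → tile i c ≡ just elbow → ∃[ q ] Reach q i c fromTop
  elbow-fed-from-above elbow≡ =
    let p , q = tile-bounded elbow≡ in pipe-from-above p q (<⇒≤ (proj₂ (elbow⇒FreeZone elbow≡)))

  vertical⇒above-pivot : ∀ {i c} → tile i c ≡ just vertical → i < pivotRow c
  vertical⇒above-pivot tile≡ with uncurry shape (tile-bounded tile≡)
  ... | vert-zone _ r> _         = r>
  ... | at-pivot _ t≡            = contradiction (tile-unique tile≡ t≡) λ ()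
  ... | empty-zone _ _ t≡        = contradiction (tile-unique tile≡ t≡) λ ()
  ... | horiz-zone _ _ t≡        = contradiction (tile-unique tile≡ t≡) λ ()
  ... | free-zone _ _ (inj₁ t≡)  = contradiction (tile-unique tile≡ t≡) λ ()
  ... | free-zone _ _ (inj₂ t≡)  = contradiction (tile-unique tile≡ t≡) λ ()

  descends⇒above-pivot : ∀ {i c e} → Routes i c e toBottom → i < pivotRow c
  descends⇒above-pivot (vertical , tile≡ , _) = vertical⇒above-pivot tile≡
  descends⇒above-pivot (cross , tile≡ , _)    = proj₂ (cross⇒FreeZone tile≡)
  descends⇒above-pivot (elbow , tile≡ , _)    = proj₂ (elbow⇒FreeZone tile≡)
  descends⇒above-pivot {e = fromTop}  (empty , _ , ())
  descends⇒above-pivot {e = fromLeft} (empty , _ , ())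
  descends⇒above-pivot {e = fromTop}  (horizontal , _ , ())
  descends⇒above-pivot {e = fromLeft} (horizontal , _ , ())
  descends⇒above-pivot {e = fromTop}  (pivot , _ , ())
  descends⇒above-pivot {e = fromLeft} (pivot , _ , ())

  top-entry⇒above-pivot : ∀ {x i c} → Reach x i c fromTop → i ≤ pivotRow c
  top-entry⇒above-pivot (start _)         = z≤n
  top-entry⇒above-pivot (down _ routes _) = descends⇒above-pivot routes

  left-entry⇒right-of-pivot : ∀ {x i c} → Reach x i c fromLeft → pivotCol i < c
  left-entry⇒right-of-pivot r with run r
  ... | R with turn-tile (Run.turned R)
  ...   | inj₁ is-pivot = subst (_< _) (pivot⇒pivotCol is-pivot) (Run.from<c R)
  ...   | inj₂ is-elbow = <-trans (proj₁ (elbow⇒FreeZone is-elbow)) (Run.from<c R)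

module FlagPositroid {n : ℕ} {u v : Permutation′ n} {G : Grid n} (fpp : IsFPP u v G) where
  open IsFPP fpp
  open IsRothe rothe using (pipesExit)
  open Tracing G
  open Meetings G
  open RotheShape u G rothe

  never-broken : ∀ {x} → pipeEnd G x ≢ broken
  never-broken {x} end≡ with pipesExit x
  ... | _ , exits = case trans (sym end≡) exits of λ ()

  continue-down : ∀ {x i c e} → Reach x i c e → Routes i c e toBottom → Reach x (suc i) c fromTop
  continue-down {i = i} r routes with suc i <? n
  ... | yes i+1<n = down r routes i+1<n
  ... | no i+1≮n  = contradiction (Reach⇒fallsOff r routes i+1≡n) never-broken
    where
    i+1≡n : suc i ≡ n
    i+1≡n = ≤-antisym (proj₁ (Reach-bounded r)) (≮⇒≥ i+1≮n)

  exiting-pipe : ∀ {x a} → pipeEnd G x ≡ exitsRight (toℕ a) → x ≡ v ⟨$⟩ʳ a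
  exiting-pipe {x} {a} end≡ = begin
    x                 ≡⟨ inverseʳ v ⟨
    v ⟨$⟩ʳ (v ⟨$⟩ˡ x)  ≡⟨ cong (v ⟨$⟩ʳ_) (toℕ-injective (exit-row (trans (sym exits) end≡))) ⟩
    v ⟨$⟩ʳ a          ∎
    where
    open ≡-Reasoning
    exits : pipeEnd G x ≡ exitsRight (toℕ (v ⟨$⟩ˡ x))
    exits = subst (λ y → pipeEnd G y ≡ exitsRight (toℕ (v ⟨$⟩ˡ x))) (inverseʳ v) (exitPerm _)
    exit-row : ∀ {r r′} → exitsRight r ≡ exitsRight r′ → r ≡ r′
    exit-row refl = refl

  overtaken-from-left : ∀ {y i d} → Reach y i d fromTop → pivotCol i < d →
                        ∃[ g ] (Reach g i d fromLeft × g Fin.< y)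
  overtaken-from-left {i = i} {d} ry d> with Reach-bounded ry
  ... | p , q with right-of-pivot p q d>
  ...   | horizontal-tile t≡ = contradiction (Reach⇒stuck ry t≡ refl) never-broken
  ...   | cross-tile t≡ =
    let g , rg = pipe-from-left p q d> in g , rg , left<top-at-cross reduced t≡ rg ry
  ...   | elbow-tile t≡ =
    let g , rg = pipe-from-left p q d> in g , rg , left<top-at-elbow noTouchSE t≡ rg ry

  descends-from : ∀ {y i d} → Reach y i d fromTop → pivotCol i < d →
                  ∃[ z ] (Reach z (suc i) d fromTop × z Fin.≤ y)
  descends-from {i = i} {d} ry d> with Reach-bounded ry
  ... | p , q with right-of-pivot p q d>
  ...   | horizontal-tile t≡ = contradiction (Reach⇒stuck ry t≡ refl) never-broken
  ...   | cross-tile t≡ = _ , continue-down ry (cross , t≡ , refl) , ≤-refl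
  ...   | elbow-tile t≡ =
    let g , rg , g<y = overtaken-from-left ry d> in g , continue-down rg (elbow-routes t≡) , <⇒≤ g<y

  mutual
    descends-before-elbow : ∀ gap {h i d} → Reach h i d fromLeft → tile i (gap + d) ≡ just elbow →
                            ∃[ e ] (d ≤ e × Reach h (suc i) e fromTop)
    descends-before-elbow gap {d = d} rh elbow≡ with Reach-bounded rh
    ... | p , q with right-of-pivot p q (left-entry⇒right-of-pivot rh)
    ...   | elbow-tile t≡      = d , ≤-refl , continue-down rh (elbow-routes t≡)
    ...   | horizontal-tile t≡ = passes-before-elbow gap rh (horizontal , t≡ , refl) elbow≡
    ...   | cross-tile t≡      = passes-before-elbow gap rh (cross , t≡ , refl) elbow≡

    passes-before-elbow : ∀ gap {h i d} → Reach h i d fromLeft → Routes i d fromLeft toRight →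
                          tile i (gap + d) ≡ just elbow → ∃[ e ] (d ≤ e × Reach h (suc i) e fromTop)
    passes-before-elbow zero rh routes elbow≡ =
      ⊥-elim (turns-and-descends routes (elbow-routes elbow≡))
    passes-before-elbow (suc gap) {i = i} {d} rh routes elbow≡ =
      let e , d+1≤e , r = descends-before-elbow gap (right rh routes d+1<n)
                            (subst (λ c → tile i c ≡ just elbow) (sym (+-suc gap d)) elbow≡)
      in e , <⇒≤ d+1≤e , r
      where
      d+1<n : suc d < n
      d+1<n = ≤-<-trans (s≤s (m≤n+m d gap)) (proj₂ (tile-bounded elbow≡))

  top-at-elbow≤left-beyond : ∀ {q i c} → tile i c ≡ just elbow → Reach q i c fromTop →
                             ∀ {g d} → c < d → Reach g i d fromLeft → q Fin.≤ g
  top-at-elbow≤left-beyond elbow≡ rq c<d+1 (right {e = fromTop} r₀ routes _)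
    with m≤n⇒m<n∨m≡n (s≤s⁻¹ c<d+1)
  ... | inj₂ refl = ≤-reflexive (cong toℕ (Reach-injective rq r₀))
  ... | inj₁ c<d with turn-tile routes
  ...   | inj₁ is-pivot =
    contradiction (pivot⇒pivotCol is-pivot) (>⇒≢ (<-trans (proj₁ (elbow⇒FreeZone elbow≡)) c<d))
  ...   | inj₂ is-elbow =
    let p , q = Reach-bounded r₀
        g′ , rg′ = pipe-from-left p q (<-trans (proj₁ (elbow⇒FreeZone elbow≡)) c<d)
    in <⇒≤ (≤-<-trans (top-at-elbow≤left-beyond elbow≡ rq c<d rg′)
                      (left<top-at-elbow noTouchSE is-elbow rg′ r₀))
  top-at-elbow≤left-beyond elbow≡ rq c<d+1 (right {e = fromLeft} r₀ routes _)
    with m≤n⇒m<n∨m≡n (s≤s⁻¹ c<d+1)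
  ... | inj₂ refl = ⊥-elim (turns-and-descends routes (elbow-routes elbow≡))
  ... | inj₁ c<d  = top-at-elbow≤left-beyond elbow≡ rq c<d r₀

  BlockedAbove : ℕ → ℕ → Set
  BlockedAbove i c =
    ∃[ i₀ ] (i₀ < i × tile i₀ c ≡ just cross × ∃[ c′ ] (c < c′ × tile i₀ c′ ≡ just elbow))

  BlockedAbove-suc : ∀ {i c} → BlockedAbove i c → BlockedAbove (suc i) c
  BlockedAbove-suc (i₀ , i₀<i , blocker) = i₀ , m<n⇒m<1+n i₀<i , blocker

  BlockedAbove-pred : ∀ {i c} (b : BlockedAbove (suc i) c) → proj₁ b < i → BlockedAbove i c
  BlockedAbove-pred (i₀ , _ , blocker) i₀<i = i₀ , i₀<i , blocker

  unblocked⇒increasing : ∀ i {x y c c′} → ¬ BlockedAbove i c →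
                         Reach x i c fromTop → c < c′ → Reach y i c′ fromTop → x Fin.< y
  unblocked⇒increasing zero _ (start refl) c<c′ (start refl) = c<c′
  unblocked⇒increasing (suc i) {x} {y} {c} {c′} clear rx c<c′ ry with descent rx | descent ry
  ... | straight a _ | straight b _ = unblocked⇒increasing i (clear ∘ BlockedAbove-suc) a c<c′ b
  ... | straight a down-a | turning R′ elbow′ with <-cmp (Run.from R′) c
  ...   | tri< from<c _ _ = ⊥-elim (clear (i , n<1+n i , is-cross , c′ , c<c′ , elbow′))
    where
    is-cross : tile i c ≡ just cross
    is-cross = Routes⇒cross down-a (Run.passes R′ c from<c c<c′)
  ...   | tri≈ _ refl _ = ⊥-elim (turns-and-descends (Run.turned R′) down-a)
  ...   | tri> _ _ c<from = unblocked⇒increasing i (clear ∘ BlockedAbove-suc) a c<from (Run.entered R′)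
  unblocked⇒increasing (suc i) {x} {y} {c} {c′} clear rx c<c′ ry | turning R elbow≡ | y-descent
    with elbow-fed-from-above elbow≡
  ... | q , rq = <-≤-trans (left<top-at-elbow noTouchSE elbow≡ (Run⇒Reach R) rq) (q≤y y-descent)
    where
    increasing : ∀ {y c′} → c < c′ → Reach y i c′ fromTop → q Fin.< y
    increasing = unblocked⇒increasing i (clear ∘ BlockedAbove-suc) rq
    q≤y : Descent y i c′ → q Fin.≤ y
    q≤y (straight b _) = <⇒≤ (increasing c<c′ b)
    q≤y (turning R′ _) with <-cmp (Run.from R′) c
    ... | tri< from<c _ _ = ⊥-elim (turns-and-descends (Run.passes R′ c from<c c<c′) (elbow-routes elbow≡))
    ... | tri≈ _ refl _   = ≤-reflexive (cong toℕ (Reach-injective rq (Run.entered R′)))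
    ... | tri> _ _ c<from = <⇒≤ (increasing c<from (Run.entered R′))

module TrivialCompletion
  (n k : ℕ) (k≤n : k ≤ n) (u v : Permutation′ n) (G : Grid n) (fpp : IsFPP u v G)
  (decreasing-first : DecreasingFirst k u) (decreasing-rest : DecreasingRest k u)
  where

  open IsFPP fpp
  open Tracing G
  open RotheShape u G rothe
  open FlagPositroid fpp

  private
    fromℕ<-mono : ∀ {a b} (p : a < n) (q : b < n) → a < b → fromℕ< p Fin.< fromℕ< q
    fromℕ<-mono p q = subst₂ _<_ (sym (toℕ-fromℕ< p)) (sym (toℕ-fromℕ< q))

  pivotCol-decreasing-first : ∀ {i i′} → i < i′ → i′ < k → pivotCol i′ < pivotCol i
  pivotCol-decreasing-first i<i′ i′<k =
    let p′ = <-≤-trans i′<k k≤n ; p = <-trans i<i′ p′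
    in subst₂ _<_ (sym (pivotCol-inside p′)) (sym (pivotCol-inside p))
         (decreasing-first _ _ (fromℕ<-mono p p′ i<i′) (subst (_< k) (sym (toℕ-fromℕ< p′)) i′<k))

  pivotCol-decreasing-rest : ∀ {i i′} → k ≤ i → i < i′ → i′ < n → pivotCol i′ < pivotCol i
  pivotCol-decreasing-rest k≤i i<i′ p′ =
    let p = <-trans i<i′ p′
    in subst₂ _<_ (sym (pivotCol-inside p′)) (sym (pivotCol-inside p))
         (decreasing-rest _ _ (subst (k ≤_) (sym (toℕ-fromℕ< p)) k≤i) (fromℕ<-mono p p′ i<i′))

  Overtaken : ℕ → ℕ → Fin n → Set
  Overtaken i c x = ∃[ c′ ] (c < c′ × ∃[ y ] (Reach y i c′ fromTop × y Fin.< x))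

  blocked⇒overtaken : ∀ i {x c} → i ≤ k → BlockedAbove i c → Reach x i c fromTop →
                      Overtaken i c x
  blocked⇒overtaken (suc i) {x} {c} i+1≤k blocked@(i₀ , i₀<i+1 , cross≡ , c″ , c<c″ , elbow≡) rx
    with m≤n⇒m<n∨m≡n (s≤s⁻¹ i₀<i+1) | descent rx
  ... | inj₂ refl | turning _ elbow-c = contradiction (tile-unique cross≡ elbow-c) λ ()
  ... | inj₂ refl | straight a _ =
    let g , rg , g<x = overtaken-from-left a (proj₁ (cross⇒FreeZone cross≡))
        c+1<n = ≤-<-trans c<c″ (proj₂ (tile-bounded elbow≡))
        e , c<e , re = descends-before-elbow (c″ ∸ suc c) (right rg (cross , cross≡ , refl) c+1<n)
                         (subst (λ d → tile i d ≡ just elbow) (sym (m∸n+n≡m c<c″)) elbow≡)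
    in e , c<e , g , re , g<x
  ... | inj₁ i₀<i | straight a _ =
    let c′ , c<c′ , y , ry , y<x = blocked⇒overtaken i (<⇒≤ i+1≤k) (BlockedAbove-pred blocked i₀<i) a
        pivot<c = <-trans (pivotCol-decreasing-first i₀<i i+1≤k) (proj₁ (cross⇒FreeZone cross≡))
        z , rz , z≤y = descends-from ry (<-trans pivot<c c<c′)
    in c′ , c<c′ , z , rz , ≤-<-trans z≤y y<x
  ... | inj₁ i₀<i | turning _ elbow-c =
    let q , rq = elbow-fed-from-above elbow-c
        d , c<d , y , ry , y<q = blocked⇒overtaken i (<⇒≤ i+1≤k) (BlockedAbove-pred blocked i₀<i) rq
        g , rg , g<y = overtaken-from-left ry (<-trans (proj₁ (elbow⇒FreeZone elbow-c)) c<d)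
    in contradiction (<-trans g<y y<q) (≤⇒≯ (top-at-elbow≤left-beyond elbow-c rq c<d rg))

  column-pivotRow : (j : Fin n) → pivotRow (toℕ j) ≡ toℕ (u ⟨$⟩ˡ j)
  column-pivotRow j = trans (pivotRow-inside (toℕ<n j)) (cong (toℕ ∘ (u ⟨$⟩ˡ_)) (fromℕ<-toℕ j _))

  OneColoured⇒k≤pivotRow : ∀ {j} → OneColoured k u j → k ≤ pivotRow (toℕ j)
  OneColoured⇒k≤pivotRow {j} one = subst (k ≤_) (sym (column-pivotRow j)) (≮⇒≥ one)

  k≤pivotRow⇒OneColoured : ∀ {j} → k ≤ pivotRow (toℕ j) → OneColoured k u j
  k≤pivotRow⇒OneColoured {j} k≤r two = <⇒≱ two (subst (k ≤_) (column-pivotRow j) k≤r)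

  vertical-below-k : ∀ {i c} → c < n → k ≤ i → i < pivotRow c → tile i c ≡ just vertical
  vertical-below-k {i} {c} q k≤i i<r = vertical-zone (<-trans i<r (pivotRow<n q)) q c<pivot i<r
    where
    c<pivot : c < pivotCol i
    c<pivot = subst (_< _) (pivotCol-pivotRow q) (pivotCol-decreasing-rest k≤i i<r (pivotRow<n q))

  horizontal-below-k : ∀ {r d} → r < n → d < n → k ≤ r → pivotCol r < d →
                       tile r d ≡ just horizontal
  horizontal-below-k {r} {d} p q k≤r d> with <-cmp (pivotRow d) r
  ... | tri< r< _ _ = horizontal-zone p q d> r<
  ... | tri≈ _ r≡ _ = contradiction (pivotRow≡⇒pivotCol≡ q r≡) (>⇒≢ d>)
  ... | tri> _ _ r> = contradiction d<pivot (<⇒≯ d>)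
    where
    d<pivot : d < pivotCol r
    d<pivot = subst (_< _) (pivotCol-pivotRow q) (pivotCol-decreasing-rest k≤r r> (pivotRow<n q))

  exits-at-pivot-row : ∀ {x c} → Reach x k c fromTop → pipeEnd G x ≡ exitsRight (pivotRow c)
  exits-at-pivot-row {x} {c} rx = exits-along-row reaches-pivot turns horizontals
    where
    q : c < n
    q = proj₂ (Reach-bounded rx)
    r<n : pivotRow c < n
    r<n = pivotRow<n q
    k≤r : k ≤ pivotRow c
    k≤r = top-entry⇒above-pivot rx
    reaches-pivot : Reach x (pivotRow c) c fromTop
    reaches-pivot = straight-down rx k≤r r<n (λ _ → vertical-below-k q)
    turns : Routes (pivotRow c) c fromTop toRight
    turns = pivot , subst (λ d → tile (pivotRow c) d ≡ just pivot) (pivotCol-pivotRow q) (pivot-tile r<n) ,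
            refl
    horizontals : ∀ d → c < d → d < n → tile (pivotRow c) d ≡ just horizontal
    horizontals d c<d d<n =
      horizontal-below-k r<n d<n k≤r (subst (_< d) (sym (pivotCol-pivotRow q)) c<d)

  pipe-below-row-k : (j : Fin n) → OneColoured k u j → Reach (decPerm u v j) k (toℕ j) fromTop
  pipe-below-row-k j one =
    let k≤r = OneColoured⇒k≤pivotRow one
        x , rx = pipe-from-above (≤-<-trans k≤r (pivotRow<n (toℕ<n j))) (toℕ<n j) k≤r
        exits = trans (exits-at-pivot-row rx) (cong exitsRight (column-pivotRow j))
    in subst (λ y → Reach y k (toℕ j) fromTop) (exiting-pipe exits) rx

  overtaken-position : ∀ {j} → Overtaken k (toℕ j) (decPerm u v j) →
    ∃[ j′ ] (j Fin.< j′ × OneColoured k u j′ × decPerm u v j′ Fin.< decPerm u v j)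
  overtaken-position {j} (c′ , j<c′ , y , ry , y<πj) =
    j′ , subst (toℕ j <_) (sym c′≡) j<c′ , one′ , subst (Fin._< decPerm u v j) y≡πj′ y<πj
    where
    j′ : Fin n
    j′ = fromℕ< (proj₂ (Reach-bounded ry))
    c′≡ : toℕ j′ ≡ c′
    c′≡ = toℕ-fromℕ< _
    ry′ : Reach y k (toℕ j′) fromTop
    ry′ = subst (λ c → Reach y k c fromTop) (sym c′≡) ry
    one′ : OneColoured k u j′
    one′ = k≤pivotRow⇒OneColoured (top-entry⇒above-pivot ry′)
    y≡πj′ : y ≡ decPerm u v j′
    y≡πj′ = Reach-injective ry′ (pipe-below-row-k j′ one′)

  D : PGrid k n
  D = restrict k≤n G

  restrict-tile : (i : Fin k) (b : Fin n) → tile (toℕ i) (toℕ b) ≡ just (D i b)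
  restrict-tile i b = subst (λ r → tile r (toℕ b) ≡ just (D i b)) (toℕ-inject≤ i k≤n) (tile-Fin _ b)

  CrossElbowBlocked : Fin n → Set
  CrossElbowBlocked j = ∃[ i ] ∃[ j′ ] (D i j ≡ cross × j Fin.< j′ × D i j′ ≡ elbow)

  BlockedAbove⇒CrossElbowBlocked : ∀ {j} → BlockedAbove k (toℕ j) → CrossElbowBlocked j
  BlockedAbove⇒CrossElbowBlocked {j} (i , i<k , cross≡ , c′ , j<c′ , elbow≡) =
    I , J′ ,
    tile-unique (restrict-tile I j) (subst (λ r → tile r (toℕ j) ≡ just cross) (sym I≡) cross≡) ,
    subst (toℕ j <_) (sym J′≡) j<c′ ,
    tile-unique (restrict-tile I J′) (subst₂ (λ r c → tile r c ≡ just elbow) (sym I≡) (sym J′≡) elbow≡)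
    where
    I : Fin k
    I = fromℕ< i<k
    I≡ : toℕ I ≡ i
    I≡ = toℕ-fromℕ< i<k
    J′ : Fin n
    J′ = fromℕ< (proj₂ (tile-bounded elbow≡))
    J′≡ : toℕ J′ ≡ c′
    J′≡ = toℕ-fromℕ< _

  CrossElbowBlocked⇒BlockedAbove : ∀ {j} → CrossElbowBlocked j → BlockedAbove k (toℕ j)
  CrossElbowBlocked⇒BlockedAbove {j} (i , j′ , cross≡ , j<j′ , elbow≡) =
    toℕ i , toℕ<n i , trans (restrict-tile i j) (cong just cross≡) ,
    toℕ j′ , j<j′ , trans (restrict-tile i j′) (cong just elbow≡)

  TwoColoured⇒pivot : ∀ {j} → TwoColoured k u j → ∃[ i ] D i j ≡ pivot
  TwoColoured⇒pivot {j} two = I , (begin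
    G (Fin.inject≤ I k≤n) j           ≡⟨ cong (λ a → G a j) inject≡ ⟩
    G (u ⟨$⟩ˡ j) j                     ≡⟨ cong (G (u ⟨$⟩ˡ j)) (inverseʳ u) ⟨
    G (u ⟨$⟩ˡ j) (u ⟨$⟩ʳ (u ⟨$⟩ˡ j))    ≡⟨ IsRothe.pivotTile rothe (u ⟨$⟩ˡ j) ⟩
    pivot                             ∎)
    where
    open ≡-Reasoning
    I : Fin k
    I = fromℕ< two
    inject≡ : Fin.inject≤ I k≤n ≡ u ⟨$⟩ˡ j
    inject≡ = toℕ-injective (trans (toℕ-inject≤ I k≤n) (toℕ-fromℕ< two))

  pivot⇒TwoColoured : ∀ {i j} → D i j ≡ pivot → TwoColoured k u j
  pivot⇒TwoColoured {i} {j} pivot≡ = subst (_< k) row≡ (toℕ<n i)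
    where
    open ≡-Reasoning
    j≡pivotCol : toℕ j ≡ pivotCol (toℕ i)
    j≡pivotCol = pivot⇒pivotCol (trans (restrict-tile i j) (cong just pivot≡))
    row≡ : toℕ i ≡ toℕ (u ⟨$⟩ˡ j)
    row≡ = begin
      toℕ i                        ≡⟨ pivotRow-pivotCol (<-≤-trans (toℕ<n i) k≤n) ⟨
      pivotRow (pivotCol (toℕ i))  ≡⟨ cong pivotRow j≡pivotCol ⟨
      pivotRow (toℕ j)             ≡⟨ column-pivotRow j ⟩
      toℕ (u ⟨$⟩ˡ j)               ∎

lemma5p4 : (n k : ℕ) (k≤n : k ≤ n) (u v : Permutation′ n) (G : Grid n) →
    IsFPP u v G → DecreasingFirst k u → DecreasingRest k u →
    (j : Fin n) → UnblockedCol (restrict k≤n G) j ⇔ UnblockedPos k u v j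
lemma5p4 n k k≤n u v G fpp decreasing-first decreasing-rest j = mk⇔ to from
  where
  open TrivialCompletion n k k≤n u v G fpp decreasing-first decreasing-rest
  open FlagPositroid fpp using (unblocked⇒increasing)

  to : UnblockedCol D j → UnblockedPos k u v j
  to unblocked = one , λ j′ j<j′ one′ →
    unblocked⇒increasing k (unblocked ∘ inj₂ ∘ BlockedAbove⇒CrossElbowBlocked)
      (pipe-below-row-k j one) j<j′ (pipe-below-row-k j′ one′)
    where
    one : OneColoured k u j
    one = unblocked ∘ inj₁ ∘ TwoColoured⇒pivot

  from : UnblockedPos k u v j → UnblockedCol D j
  from (one , _) (inj₁ (_ , pivot≡)) = one (pivot⇒TwoColoured pivot≡)
  from (one , increasing) (inj₂ blocker) =
    let j′ , j<j′ , one′ , πj′<πj = overtaken-position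
          (blocked⇒overtaken k ≤-refl (CrossElbowBlocked⇒BlockedAbove blocker) (pipe-below-row-k j one))
    in <-asym πj′<πj (increasing j′ j<j′ one′)
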